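{- Let $H_1,\dots,H_n$ be realizable hypergroups. Then the product hypergroup $H_1\times\cdots\times H_n$ is realizable.
   Context: A hypergroup is a nonempty set $H$ with a hyperoperation $*$ from $H\times H$ to nonempty subsets of $H$ (extended to subsets by unions) which is associative, has a unique identity $e$ ($e*x=x*e=\{x\}$), unique inverses ($e\in(f^{ -1}*f)\cap(f*f^{ -1})$), and is reversible ($c\in a*b\Rightarrow a\in c*b^{ -1}$ and $b\in a^{ -1}*c$). The product of hypergroups has the componentwise hyperoperation $(a_i)*(b_i)=\prod_i(a_i*b_i)$. An isomorphism of hypergroups is a bijection $f$ with $f(a*b)=f(a)*f(b)$ for all $a,b$. For a nonempty set $X$: $1_X$ is the diagonal, $p^*=\{(a,b):(b,a)\in p\}$, $xp=\{y:(x,y)\in p\}$. An association scheme on $X$ is a partition $S$ of $X\times X$ with $1_X\in S$, closed under $p\mapsto p^*$, such that for all $p,q,r\in S$ there is a cardinal $a_{pq}^r$ with $|yp\cap zq^*|=a_{pq}^r$ for all $y\in X$, $z\in yr$. $\mathbf{H}(S)$ is the hypergroup on $S$ with hyperoperation $p*q=\{r\in S:a_{pq}^r\ge1\}$ (complex multiplication) and identity $1_X$. A hypergroup is realizable if it is isomorphic to $\mathbf{H}(S)$ for some association scheme $S$. -}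

module Defs where

open import Level using (Level; _⊔_) renaming (suc to lsuc)
open import Data.Nat using (ℕ; zero; suc)
open import Data.Fin using (Fin; zero; suc)
open import Data.Product using (Σ; ∃; _×_; _,_)
open import Data.Unit.Polymorphic using (⊤)
open import Function using (_∘_)
open import Function.Bundles using (_⇔_; _↔_; Inverse)
open import Relation.Binary.PropositionalEquality using (_≡_)

-- A hyperoperation on C: a ∗ b is a subset of C, given as a predicate.
HyperOp : ∀ {c} (m : Level) → Set c → Set (c ⊔ lsuc m)
HyperOp m C = C → C → C → Set m

record Hypergroup (ℓ : Level) : Set (lsuc ℓ) where
  field
    Carrier : Set ℓ
    _∗_     : HyperOp ℓ Carrier
    nonempty : ∀ a b → ∃ λ c → (a ∗ b) c
    -- associativity, with ∗ extended to subsets by unions: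
    -- x ∈ (a ∗ b) ∗ c  ⇔  x ∈ a ∗ (b ∗ c)
    assoc : ∀ a b c x →
      (∃ λ y → (a ∗ b) y × (y ∗ c) x) ⇔ (∃ λ y → (b ∗ c) y × (a ∗ y) x)
    e         : Carrier
    identityˡ : ∀ x y → (e ∗ x) y ⇔ (y ≡ x)
    identityʳ : ∀ x y → (x ∗ e) y ⇔ (y ≡ x)
    identity-unique : ∀ e′ →
      (∀ x y → ((e′ ∗ x) y ⇔ (y ≡ x)) × ((x ∗ e′) y ⇔ (y ≡ x))) → e′ ≡ e
    _⁻¹     : Carrier → Carrier
    inverse : ∀ f → ((f ⁻¹) ∗ f) e × (f ∗ (f ⁻¹)) e
    inverse-unique : ∀ f g → (g ∗ f) e → (f ∗ g) e → g ≡ f ⁻¹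
    reversible : ∀ a b c → (a ∗ b) c → (c ∗ (b ⁻¹)) a × ((a ⁻¹) ∗ c) b

-- Isomorphisms of hyperstructures: a bijection f with f(a ∗ b) = f(a) ⊛ f(b),
-- where f(a ∗ b) = { f c : c ∈ a ∗ b }.

record HyperIso {a b m n : Level}
                (A : Set a) (_∗_ : HyperOp m A)
                (B : Set b) (_⊛_ : HyperOp n B) : Set (a ⊔ b ⊔ m ⊔ n) where
  field
    bijection : A ↔ B
  open Inverse bijection public using (to)
  field
    homo : ∀ x y z → (∃ λ c → (x ∗ y) c × to c ≡ z) ⇔ (to x ⊛ to y) z

-- A partition S of X × X is given by an index type S together with the
-- map cls : X → X → S sending (x , y) to the block containing it; the
-- block indexed by p is { (x , y) : cls x y ≡ p }.  Blocks are nonempty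
-- (cls is surjective) and distinct indices give distinct (disjoint) blocks.

record IsAssociationScheme {x s : Level} (X : Set x) (S : Set s)
                           (cls : X → X → S) : Set (x ⊔ s) where
  field
    blocks-nonempty : ∀ p → ∃ λ y → ∃ λ z → cls y z ≡ p
    diagonal : ∃ λ p₀ → ∀ y z → (cls y z ≡ p₀) ⇔ (y ≡ z)
    transpose : ∀ p → ∃ λ q → ∀ y z → (cls z y ≡ p) ⇔ (cls y z ≡ q)
    -- intersection numbers: the cardinal |y p ∩ z q*| is the same for all
    -- y ∈ X, z ∈ y r  (equal cardinals = existence of a bijection)
    regular : ∀ p q r y z y′ z′ → cls y z ≡ r → cls y′ z′ ≡ r →
      (∃ λ w → cls y w ≡ p × cls w z ≡ q) ↔ (∃ λ w → cls y′ w ≡ p × cls w z′ ≡ q)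

-- The complex multiplication of H(S): r ∈ p ∗ q iff a_{pq}^r ≥ 1,
-- i.e. y p ∩ z q* is nonempty for (some, equivalently every) (y , z) ∈ r.
schemeOp : ∀ {x s} {X : Set x} {S : Set s} → (X → X → S) → HyperOp (x ⊔ s) S
schemeOp {X = X} cls p q r =
  ∃ λ y → ∃ λ z → cls y z ≡ r × (∃ λ w → cls y w ≡ p × cls w z ≡ q)

record Realizable {ℓ m : Level} (x : Level) (C : Set ℓ) (_∗_ : HyperOp m C)
       : Set (lsuc x ⊔ lsuc ℓ ⊔ m) where
  field
    X      : Set x
    S      : Set ℓ
    cls    : X → X → S
    scheme : IsAssociationScheme X S cls
    iso    : HyperIso C _∗_ S (schemeOp cls)

RealizableHG : ∀ {ℓ} (x : Level) → Hypergroup ℓ → Set (lsuc x ⊔ lsuc ℓ)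
RealizableHG x H = Realizable x Carrier _∗_
  where open Hypergroup H

-- Product hypergroup H₁ × ⋯ × Hₙ (componentwise hyperoperation),
-- realised as iterated binary product H₁ × (H₂ × (⋯ × (Hₙ × 𝟙))).

ProdCarrier : ∀ {ℓ} (n : ℕ) → (Fin n → Hypergroup ℓ) → Set ℓ
ProdCarrier zero    H = ⊤
ProdCarrier (suc n) H = Hypergroup.Carrier (H zero) × ProdCarrier n (H ∘ suc)

prodOp : ∀ {ℓ} (n : ℕ) (H : Fin n → Hypergroup ℓ) → HyperOp ℓ (ProdCarrier n H)
prodOp zero    H a b c = ⊤
prodOp (suc n) H (a , as) (b , bs) (c , cs) =
  Hypergroup._∗_ (H zero) a b c × prodOp n (H ∘ suc) as bs cs

module Submission where

-- If S₁ on X₁ and S₂ on X₂ are association schemes, the blocks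
-- p × p′ = {((y , y′) , (z , z′)) : (y , z) ∈ p, (y′ , z′) ∈ p′} form an
-- association scheme S₁ ⊗ S₂ on X₁ × X₂: a path y → w → z in the product
-- is a pair of paths in the factors, so intersection numbers multiply and
-- r × r′ ∈ (p × p′)(q × q′) iff r ∈ pq and r′ ∈ p′q′.  Hence the complex
-- multiplication of S₁ ⊗ S₂ is the componentwise product of those of S₁
-- and S₂, and a product of hyperisomorphisms H₁ ≅ H(S₁), H₂ ≅ H(S₂) is a
-- hyperisomorphism H₁ × H₂ ≅ H(S₁ ⊗ S₂).
--
-- The theorem follows by induction on n, the empty
-- product being realized by the one-point scheme.

open import Defs
open import Level using (Level; _⊔_)
open import Data.Nat using (ℕ; zero; suc)
open import Data.Fin using (Fin; zero; suc)
open import Data.Product using (∃; _×_; _,_; proj₁; proj₂)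
open import Data.Product.Properties using (×-≡,≡↔≡; ,-injective)
open import Data.Product.Function.NonDependent.Propositional using (_×-↔_; _×-⇔_)
open import Data.Unit.Polymorphic using (⊤; tt)
open import Function using (_∘_)
open import Function.Bundles using (_⇔_; _↔_; Inverse; mk↔ₛ′; mk⇔)
open import Function.Construct.Identity using (↔-id)
open import Function.Construct.Composition using (_↔-∘_; _⇔-∘_)
open import Function.Construct.Symmetry using (↔-sym; ⇔-sym)
open import Function.Properties.Inverse using (↔⇒⇔)
open import Relation.Binary.PropositionalEquality using (_≡_; refl)

private
  variable
    a b c d m m′ n n′ : Level
    A B : Set a
    X₁ X₂ S₁ S₂ : Set a

-- Paths of shape p · q from y to z: the set y p ∩ z q* whose cardinality
-- is the intersection number a_{pq}^r when (y , z) ∈ r.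
Paths : (X₁ → X₁ → S₁) → S₁ → S₁ → X₁ → X₁ → Set _
Paths cls p q y z = ∃ λ w → cls y w ≡ p × cls w z ≡ q

_⊗_ : (X₁ → X₁ → S₁) → (X₂ → X₂ → S₂) → (X₁ × X₂ → X₁ × X₂ → S₁ × S₂)
(cls₁ ⊗ cls₂) (y , y′) (z , z′) = cls₁ y z , cls₂ y′ z′

_⊠_ : HyperOp m A → HyperOp n B → HyperOp (m ⊔ n) (A × B)
(_∗_ ⊠ _⊛_) (x , x′) (y , y′) (z , z′) = (x ∗ y) z × (x′ ⊛ y′) z′

pair-≡⇔ : {s s′ : A} {t t′ : B} → ((s , t) ≡ (s′ , t′)) ⇔ (s ≡ s′ × t ≡ t′)
pair-≡⇔ = ↔⇒⇔ (↔-sym ×-≡,≡↔≡)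

×-≡-cong : {s₁ p₁ : A} {s₂ p₂ : B} {C : Set c} {D : Set d} {t₁ q₁ : C} {t₂ q₂ : D} →
           (s₁ ≡ p₁) ⇔ (t₁ ≡ q₁) → (s₂ ≡ p₂) ⇔ (t₂ ≡ q₂) →
           ((s₁ , s₂) ≡ (p₁ , p₂)) ⇔ ((t₁ , t₂) ≡ (q₁ , q₂))
×-≡-cong e₁ e₂ = ⇔-sym pair-≡⇔ ⇔-∘ ((e₁ ×-⇔ e₂) ⇔-∘ pair-≡⇔)

paths-⊗ : (cls₁ : X₁ → X₁ → S₁) (cls₂ : X₂ → X₂ → S₂) {p q : S₁} {p′ q′ : S₂}
          {y z : X₁} {y′ z′ : X₂} →
          Paths (cls₁ ⊗ cls₂) (p , p′) (q , q′) (y , y′) (z , z′)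
            ↔ (Paths cls₁ p q y z × Paths cls₂ p′ q′ y′ z′)
paths-⊗ cls₁ cls₂ = mk↔ₛ′ split join split∘join join∘split
  where
  split : Paths (cls₁ ⊗ cls₂) _ _ _ _ → Paths cls₁ _ _ _ _ × Paths cls₂ _ _ _ _
  split ((w , w′) , refl , refl) = (w , refl , refl) , (w′ , refl , refl)
  join : Paths cls₁ _ _ _ _ × Paths cls₂ _ _ _ _ → Paths (cls₁ ⊗ cls₂) _ _ _ _
  join ((w , refl , refl) , (w′ , refl , refl)) = (w , w′) , refl , refl
  split∘join : ∀ π → split (join π) ≡ π
  split∘join ((w , refl , refl) , (w′ , refl , refl)) = refl
  join∘split : ∀ π → join (split π) ≡ π
  join∘split ((w , w′) , refl , refl) = refl

⊗-isAssociationScheme : {cls₁ : X₁ → X₁ → S₁} {cls₂ : X₂ → X₂ → S₂} →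
  IsAssociationScheme X₁ S₁ cls₁ → IsAssociationScheme X₂ S₂ cls₂ →
  IsAssociationScheme (X₁ × X₂) (S₁ × S₂) (cls₁ ⊗ cls₂)
⊗-isAssociationScheme {cls₁ = cls₁} {cls₂} 𝒮₁ 𝒮₂ = record
  { blocks-nonempty = blocks-nonempty
  ; diagonal        = diagonal
  ; transpose       = transpose
  ; regular         = regular
  }
  where
  module 𝒮₁ = IsAssociationScheme 𝒮₁
  module 𝒮₂ = IsAssociationScheme 𝒮₂

  blocks-nonempty : ∀ π → ∃ λ y → ∃ λ z → (cls₁ ⊗ cls₂) y z ≡ π
  blocks-nonempty (p , p′) with 𝒮₁.blocks-nonempty p | 𝒮₂.blocks-nonempty p′
  ... | y , z , refl | y′ , z′ , refl = (y , y′) , (z , z′) , refl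

  diagonal : ∃ λ π₀ → ∀ y z → ((cls₁ ⊗ cls₂) y z ≡ π₀) ⇔ (y ≡ z)
  diagonal with 𝒮₁.diagonal | 𝒮₂.diagonal
  ... | p₀ , d₁ | p₀′ , d₂ = (p₀ , p₀′) , λ { (y , y′) (z , z′) →
        ×-≡-cong (d₁ y z) (d₂ y′ z′) }

  transpose : ∀ π → ∃ λ ρ → ∀ y z →
              ((cls₁ ⊗ cls₂) z y ≡ π) ⇔ ((cls₁ ⊗ cls₂) y z ≡ ρ)
  transpose (p , p′) with 𝒮₁.transpose p | 𝒮₂.transpose p′
  ... | q , t₁ | q′ , t₂ = (q , q′) , λ { (y , y′) (z , z′) →
        ×-≡-cong (t₁ y z) (t₂ y′ z′) }

  regular : ∀ π ρ σ y z y₁ z₁ → (cls₁ ⊗ cls₂) y z ≡ σ → (cls₁ ⊗ cls₂) y₁ z₁ ≡ σ →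
            Paths (cls₁ ⊗ cls₂) π ρ y z ↔ Paths (cls₁ ⊗ cls₂) π ρ y₁ z₁
  regular (p , p′) (q , q′) _ (y , y′) (z , z′) (y₁ , y₁′) (z₁ , z₁′) refl e =
    ↔-sym (paths-⊗ cls₁ cls₂)
      ↔-∘ ((𝒮₁.regular p q _ y z y₁ z₁ refl e₁
            ×-↔ 𝒮₂.regular p′ q′ _ y′ z′ y₁′ z₁′ refl e₂)
      ↔-∘ paths-⊗ cls₁ cls₂)
    where
    e₁ : cls₁ y₁ z₁ ≡ cls₁ y z
    e₁ = proj₁ (,-injective e)
    e₂ : cls₂ y₁′ z₁′ ≡ cls₂ y′ z′
    e₂ = proj₂ (,-injective e)

schemeOp-⊗ : (cls₁ : X₁ → X₁ → S₁) (cls₂ : X₂ → X₂ → S₂) → ∀ π ρ σ →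
             schemeOp (cls₁ ⊗ cls₂) π ρ σ ⇔ (schemeOp cls₁ ⊠ schemeOp cls₂) π ρ σ
schemeOp-⊗ cls₁ cls₂ _ _ _ = mk⇔ split join
  where
  split : ∀ {p q r p′ q′ r′} → schemeOp (cls₁ ⊗ cls₂) (p , p′) (q , q′) (r , r′) →
          schemeOp cls₁ p q r × schemeOp cls₂ p′ q′ r′
  split ((y , y′) , (z , z′) , refl , (w , w′) , refl , refl) =
    (y , z , refl , w , refl , refl) , (y′ , z′ , refl , w′ , refl , refl)
  join : ∀ {p q r p′ q′ r′} → schemeOp cls₁ p q r × schemeOp cls₂ p′ q′ r′ →
         schemeOp (cls₁ ⊗ cls₂) (p , p′) (q , q′) (r , r′)
  join ((y , z , refl , w , refl , refl) , (y′ , z′ , refl , w′ , refl , refl)) =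
    (y , y′) , (z , z′) , refl , (w , w′) , refl , refl

-- Hyperisomorphisms are closed under componentwise products: the image
-- of a product of hyperproducts is the product of the images.
HyperIso-⊠ : {C₁ : Set a} {C₂ : Set b} {S₁ : Set c} {S₂ : Set d}
  {_∗₁_ : HyperOp m C₁} {_∗₂_ : HyperOp m′ C₂} {_⊛₁_ : HyperOp n S₁} {_⊛₂_ : HyperOp n′ S₂} →
  HyperIso C₁ _∗₁_ S₁ _⊛₁_ → HyperIso C₂ _∗₂_ S₂ _⊛₂_ →
  HyperIso (C₁ × C₂) (_∗₁_ ⊠ _∗₂_) (S₁ × S₂) (_⊛₁_ ⊠ _⊛₂_)
HyperIso-⊠ {_∗₁_ = _∗₁_} {_∗₂_} f₁ f₂ = record
  { bijection = F₁.bijection ×-↔ F₂.bijection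
  ; homo      = λ { (x , x′) (y , y′) (z , z′) →
                  (F₁.homo x y z ×-⇔ F₂.homo x′ y′ z′) ⇔-∘ image-⊠ }
  }
  where
  module F₁ = HyperIso f₁
  module F₂ = HyperIso f₂
  image-⊠ : ∀ {x x′ y y′ z z′} →
    (∃ λ γ → (_∗₁_ ⊠ _∗₂_) (x , x′) (y , y′) γ
           × Inverse.to (F₁.bijection ×-↔ F₂.bijection) γ ≡ (z , z′))
      ⇔ ((∃ λ c → (x ∗₁ y) c × F₁.to c ≡ z) × (∃ λ c′ → (x′ ∗₂ y′) c′ × F₂.to c′ ≡ z′))
  image-⊠ = mk⇔ (λ { ((c , c′) , (h , h′) , refl) → (c , h , refl) , (c′ , h′ , refl) })
                (λ { ((c , h , refl) , (c′ , h′ , refl)) → (c , c′) , (h , h′) , refl })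

HyperIso-cong : {C : Set a} {S : Set b} {_∗_ : HyperOp m C} {_⊛_ _⊛′_ : HyperOp n S} →
  (∀ p q r → (p ⊛ q) r ⇔ (p ⊛′ q) r) →
  HyperIso C _∗_ S _⊛_ → HyperIso C _∗_ S _⊛′_
HyperIso-cong ⊛⇔⊛′ f = record
  { bijection = bijection
  ; homo      = λ x y z → ⊛⇔⊛′ (to x) (to y) z ⇔-∘ homo x y z
  }
  where open HyperIso f

realizable-⊠ : ∀ {ℓ} x {A B : Set ℓ} {_∗_ : HyperOp m A} {_⊛_ : HyperOp n B} →
  Realizable x A _∗_ → Realizable x B _⊛_ → Realizable x (A × B) (_∗_ ⊠ _⊛_)
realizable-⊠ x ℛ₁ ℛ₂ = record
  { X      = R₁.X × R₂.X
  ; S      = R₁.S × R₂.S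
  ; cls    = R₁.cls ⊗ R₂.cls
  ; scheme = ⊗-isAssociationScheme R₁.scheme R₂.scheme
  ; iso    = HyperIso-cong (λ p q r → ⇔-sym (schemeOp-⊗ R₁.cls R₂.cls p q r))
                           (HyperIso-⊠ R₁.iso R₂.iso)
  }
  where
  module R₁ = Realizable ℛ₁
  module R₂ = Realizable ℛ₂

point-realizable : ∀ {ℓ} x → Realizable x (⊤ {ℓ}) (λ _ _ _ → ⊤ {ℓ})
point-realizable x = record
  { X      = ⊤
  ; S      = ⊤
  ; cls    = λ _ _ → tt
  ; scheme = record
    { blocks-nonempty = λ _ → tt , tt , refl
    ; diagonal        = tt , λ _ _ → mk⇔ (λ _ → refl) (λ _ → refl)
    ; transpose       = λ _ → tt , λ _ _ → mk⇔ (λ _ → refl) (λ _ → refl)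
    ; regular         = λ _ _ _ _ _ _ _ _ _ → ↔-id _
    }
  ; iso    = record
    { bijection = ↔-id _
    ; homo      = λ _ _ _ → mk⇔ (λ _ → tt , tt , refl , tt , refl , refl)
                                (λ _ → tt , tt , refl)
    }
  }

proposition4p4 : ∀ {ℓ} (x : Level) (n : ℕ) (H : Fin n → Hypergroup ℓ) →
    (∀ i → RealizableHG x (H i)) →
    Realizable x (ProdCarrier n H) (prodOp n H)
proposition4p4 x zero    H ℛ = point-realizable x
proposition4p4 x (suc n) H ℛ =
  realizable-⊠ x (ℛ zero) (proposition4p4 x n (H ∘ suc) (ℛ ∘ suc))
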